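{- Let $\lambda$ be a partition, $n$ a positive integer, and let $\mu=(\mu_1,\dots,\mu_\ell)$ (with $\mu_\ell>0$) be the largest strict partition contained in $\lambda$. Then \[\deg(G_{\lambda,n})=|\mu|+\ell n-\frac{\ell(\ell+1)}{2}.\]
   Context: Partitions are drawn in French convention (row $i$ from the bottom has $\lambda_i$ left-justified boxes). A strict partition has distinct nonzero parts; the largest strict partition contained in $\lambda$ is the strict $\mu$ with $\mu_i\le\lambda_i$ for all $i$ of maximal size. A set-valued tableau of shape $\lambda$ assigns to each box $\mathsf B$ a nonempty finite set $T(\mathsf B)$ of positive integers with $\max T(\mathsf B)<\min T(\text{box above})$ and $\max T(\mathsf B)\le\min T(\text{box to the right})$ whenever these exist; $\mathrm{SVT}(\lambda,n)$: those with entries in $\{1,\dots,n\}$. $c(T)_i$ is the number of occurrences of $i$, $d(T)=\sum_ic(T)_i$. $G_{\lambda,n}=\sum_{T\in\mathrm{SVT}(\lambda,n)}(-1)^{d(T)-|\lambda|}\mathbf{x}^{c(T)}$; $\deg$ is total degree in $x_1,\dots,x_n$. -}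

module Defs where

open import Data.Bool using (Bool; true; false; _∧_; _∨_; not; if_then_else_)
open import Data.Nat using (ℕ; zero; suc; _+_; _*_; _∸_; _≤_; _<_; _>_; _≥_; _≤ᵇ_; _<ᵇ_)
import Data.Nat.Properties as ℕP
open import Data.Fin using (Fin; toℕ)
open import Data.Fin.Subset using (Subset)
open import Data.List using (List; []; _∷_; map; concatMap; filter; allFin; length)
open import Data.Bool.ListAction using (and; any)
open import Data.Nat.ListAction using (sum)
import Data.List as L
open import Data.List.Relation.Unary.All using (All)
open import Data.List.Relation.Unary.Linked using (Linked)
open import Data.Vec using (Vec; lookup; tabulate)
import Data.Vec.Properties as VP
open import Data.Integer using (ℤ; +_; -_)
import Data.Integer as ℤ
open import Data.Product using (Σ; _×_; ∃)
open import Relation.Nullary using (¬_)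
open import Relation.Nullary.Decidable using (⌊_⌋)
open import Relation.Binary.PropositionalEquality using (_≡_)

-- Partitions: a partition λ = (λ₁ ≥ λ₂ ≥ … > 0) is a list of positive,
-- weakly decreasing naturals; row i (from the bottom, French) has λ_i boxes.

IsPartition : List ℕ → Set
IsPartition λ' = All (0 <_) λ' × Linked _≥_ λ'

IsStrictPartition : List ℕ → Set
IsStrictPartition μ = All (0 <_) μ × Linked _>_ μ

part : List ℕ → ℕ → ℕ
part []       _       = 0
part (x ∷ xs) zero    = x
part (x ∷ xs) (suc i) = part xs i

size : List ℕ → ℕ
size = sum

_⊆ₚ_ : List ℕ → List ℕ → Set
μ ⊆ₚ λ' = ∀ i → part μ i ≤ part λ' i

IsLargestStrictIn : List ℕ → List ℕ → Set
IsLargestStrictIn μ λ' =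
  IsStrictPartition μ × μ ⊆ₚ λ' ×
  (∀ ν → IsStrictPartition ν → ν ⊆ₚ λ' → size ν ≤ size μ)

-- Set-valued tableaux with entries in {1,…,n}, the entry i+1 being
-- encoded by  i : Fin n.
-- A filling of shape λ is a list of rows (bottom row first), row i being a
-- list of λ_i subsets (left to right).

Filling : ℕ → Set
Filling n = List (List (Subset n))

nonemptyᵇ : ∀ {n} → Subset n → Bool
nonemptyᵇ {n} S = any (λ i → lookup S i) (allFin n)

-- max S ≤ min S'  (for nonempty S, S'): every a ∈ S, b ∈ S' satisfy a ≤ b
maxLeMinᵇ : ∀ {n} → Subset n → Subset n → Bool
maxLeMinᵇ {n} S S' =
  and (concatMap (λ a → map (λ b → not (lookup S a ∧ lookup S' b) ∨ (toℕ a ≤ᵇ toℕ b)) (allFin n)) (allFin n))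

maxLtMinᵇ : ∀ {n} → Subset n → Subset n → Bool
maxLtMinᵇ {n} S S' =
  and (concatMap (λ a → map (λ b → not (lookup S a ∧ lookup S' b) ∨ (toℕ a <ᵇ toℕ b)) (allFin n)) (allFin n))

rowOKᵇ : ∀ {n} → List (Subset n) → Bool
rowOKᵇ []             = true
rowOKᵇ (S ∷ [])       = nonemptyᵇ S
rowOKᵇ (S ∷ S' ∷ row) = nonemptyᵇ S ∧ maxLeMinᵇ S S' ∧ rowOKᵇ (S' ∷ row)

-- column condition between a row and the row above it: strict increase
-- upwards, for every box of the upper row (its lower neighbour exists)
colOKᵇ : ∀ {n} → List (Subset n) → List (Subset n) → Bool
colOKᵇ (S ∷ lower) (S' ∷ upper) = maxLtMinᵇ S S' ∧ colOKᵇ lower upper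
colOKᵇ _           _            = true

validᵇ : ∀ {n} → Filling n → Bool
validᵇ []                  = true
validᵇ (r ∷ [])            = rowOKᵇ r
validᵇ (r ∷ r' ∷ rows)     = rowOKᵇ r ∧ colOKᵇ r r' ∧ validᵇ (r' ∷ rows)

allSubsets : (n : ℕ) → List (Subset n)
allSubsets zero    = Data.Vec.[] ∷ []
allSubsets (suc n) = concatMap (λ s → (false Data.Vec.∷ s) ∷ (true Data.Vec.∷ s) ∷ []) (allSubsets n)

allRows : (n k : ℕ) → List (List (Subset n))
allRows n zero    = [] ∷ []
allRows n (suc k) = concatMap (λ S → map (S ∷_) (allRows n k)) (allSubsets n)

allFillings : (n : ℕ) → List ℕ → List (Filling n)
allFillings n []        = [] ∷ []
allFillings n (k ∷ λ')  = concatMap (λ r → map (r ∷_) (allFillings n λ')) (allRows n k)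

-- SVT(λ, n) as an explicit finite list (each tableau exactly once)
SVT : List ℕ → (n : ℕ) → List (Filling n)
SVT λ' n = L.filter (λ T → Relation.Nullary.Decidable.Core.T? (validᵇ T)) (allFillings n λ')
  where import Relation.Nullary.Decidable.Core

content : ∀ {n} → Filling n → Vec ℕ n
content {n} T = tabulate (λ i → sum (map (λ S → if lookup S i then 1 else 0) (L.concat T)))

vsum : ∀ {n} → Vec ℕ n → ℕ
vsum = Data.Vec.sum

d : ∀ {n} → Filling n → ℕ
d T = vsum (content T)

-- coefficient of x^c in G_{λ,n} = Σ_{T ∈ SVT(λ,n)} (-1)^{d(T)-|λ|} x^{c(T)}
GCoeff : List ℕ → (n : ℕ) → Vec ℕ n → ℤ
GCoeff λ' n c =
  L.foldr ℤ._+_ (+ 0)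
    (map (λ T → if ⌊ VP.≡-dec ℕP._≟_ (content T) c ⌋
                  then (- (+ 1)) ℤ.^ (d T ∸ size λ')
                  else + 0)
         (SVT λ' n))

HasDegree : ∀ {n} → (Vec ℕ n → ℤ) → ℕ → Set
HasDegree {n} f D =
  (Σ (Vec ℕ n) λ c → ¬ (f c ≡ + 0) × vsum c ≡ D) ×
  (∀ (c : Vec ℕ n) → ¬ (f c ≡ + 0) → vsum c ≤ D)

-- Replace every box S of a set-valued tableau by the interval [min S, max S]. Then |S| is at most the
-- width of the interval, the intervals weakly increase along rows and strictly up columns, and
-- conversely every such filling by intervals inside [0, n) is a set-valued tableau whose boxes have
-- exactly those widths. Tableaux of equal content carry equal signs, so nothing cancels in G and its
-- degree is the largest total width of an interval filling of shape λ.
-- Let μ be the largest strict partition inside λ; it is found greedily row by row. Hook i consists of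
-- the first μᵢ boxes of row i and the boxes above the last of them, and these hooks tile the diagram.
-- Along a row the widths telescope, up a column every interval starts above the previous one ends,
-- and the entries of row i (counted from 0) are at least i, so hook i has width at most μᵢ + n − 1 − i.
-- Equality holds when row i is {i}, …, {i}, [i, v] and the column above continues {v + 1}, …, {n − 1}.
-- Summing over the ℓ hooks gives |μ| + ℓn − ℓ(ℓ + 1)/2.

module Submission where

open import Defs
open import Data.Nat using (ℕ; suc; _+_; _*_; _∸_; _≤_; _/_)
open import Data.List using (List; length)

open import Data.Bool using (Bool; true; false; T; not; _∧_; _∨_; if_then_else_)
open import Data.Bool.ListAction using (and)
open import Data.Bool.Properties using (T-∧)
open import Data.Empty using (⊥-elim)
open import Data.Fin using (Fin; toℕ; fromℕ<) renaming (zero to fzero; suc to fsuc)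
open import Data.Fin.Properties using (toℕ<n; toℕ-fromℕ<)
open import Data.Fin.Subset using (Subset)
import Data.Integer as ℤ
import Data.Integer.Properties as ℤ
open import Data.List using ([]; _∷_; [_]; _++_; map; concat; concatMap; allFin; take; drop; replicate; foldr)
import Data.List.Properties as List
open import Data.List.Membership.Propositional using (_∈_; find; lose)
open import Data.List.Membership.Propositional.Properties
  using (∈-allFin; ∈-concatMap⁺; ∈-concatMap⁻; ∈-map⁺; ∈-map⁻; ∈-filter⁺; ∈-filter⁻)
open import Data.List.Relation.Unary.All using (All; []; _∷_)
import Data.List.Relation.Unary.All as All
import Data.List.Relation.Unary.All.Properties as All
open import Data.List.Relation.Unary.Any as Any using (here; there)
open import Data.List.Relation.Unary.Any.Properties using (any⁺; any⁻)
open import Data.List.Relation.Unary.Linked using (Linked; []; [-]; _∷_)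
import Data.List.Relation.Unary.Linked as Linked
import Data.List.Relation.Unary.Linked.Properties as Linked
open import Data.Nat
open import Data.Nat.DivMod using (m*n/n≡m)
open import Data.Nat.ListAction using (sum)
open import Data.Nat.ListAction.Properties using (sum-++)
open import Data.Nat.Properties
open import Algebra.Properties.CommutativeSemigroup +-commutativeSemigroup
  using () renaming (interchange to +-interchange; xy∙z≈xz∙y to +-right-comm)
open import Data.Nat.Tactic.RingSolver using (solve-∀)
open import Data.Product using (∃₂; ∃-syntax; _×_; _,_; proj₁; proj₂)
open import Data.Sum using (inj₁; inj₂)
open import Data.Unit using (⊤; tt)
open import Data.Vec as Vec using (Vec; []; _∷_; lookup; tabulate)
import Data.Vec.Properties as Vec
open import Function using (_∘_; Equivalence)
open import Relation.Binary.PropositionalEquality hiding ([_])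
open import Relation.Nullary using (¬_; yes; no)
open import Relation.Nullary.Decidable using (⌊_⌋)
import Relation.Nullary.Decidable.Core as Dec

private variable n : ℕ

_∈ˢ_ : Fin n → Subset n → Set
i ∈ˢ S = T (lookup S i)

card : Subset n → ℕ
card []          = 0
card (true ∷ S)  = suc (card S)
card (false ∷ S) = card S

card-mono : (S S′ : Subset n) → (∀ i → i ∈ˢ S → i ∈ˢ S′) → card S ≤ card S′
card-mono []          []           _ = z≤n
card-mono (true ∷ S)  (true ∷ S′)  h = s≤s (card-mono S S′ (λ i → h (fsuc i)))
card-mono (true ∷ S)  (false ∷ S′) h = ⊥-elim (h fzero tt)
card-mono (false ∷ S) (true ∷ S′)  h = m≤n⇒m≤1+n (card-mono S S′ (λ i → h (fsuc i)))
card-mono (false ∷ S) (false ∷ S′) h = card-mono S S′ (λ i → h (fsuc i))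

-- segment l w = {l, …, l + w ∸ 1}
segment : ℕ → ℕ → Subset n
segment {zero}  _       _       = []
segment {suc n} (suc l) w       = false ∷ segment l w
segment {suc n} zero    zero    = false ∷ segment zero zero
segment {suc n} zero    (suc w) = true ∷ segment zero w

∈-segment⁻ : ∀ l w (i : Fin n) → i ∈ˢ segment l w → l ≤ toℕ i × toℕ i < l + w
∈-segment⁻ zero    (suc w) fzero    _ = z≤n , s≤s z≤n
∈-segment⁻ zero    zero    (fsuc i) p with () ← proj₂ (∈-segment⁻ zero zero i p)
∈-segment⁻ zero    (suc w) (fsuc i) p = z≤n , s≤s (proj₂ (∈-segment⁻ zero w i p))
∈-segment⁻ (suc l) w       (fsuc i) p = let l≤i , i<l+w = ∈-segment⁻ l w i p in s≤s l≤i , s≤s i<l+w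

∈-segment⁺ : ∀ l w (i : Fin n) → l ≤ toℕ i → toℕ i < l + w → i ∈ˢ segment l w
∈-segment⁺ zero    (suc w) fzero    _         _         = tt
∈-segment⁺ zero    (suc w) (fsuc i) _         (s≤s i<w) = ∈-segment⁺ zero w i z≤n i<w
∈-segment⁺ (suc l) w       (fsuc i) (s≤s l≤i) (s≤s i<w) = ∈-segment⁺ l w i l≤i i<w

card-segment : ∀ l w → l + w ≤ n → card (segment {n} l w) ≡ w
card-segment {n}     zero    zero    _ = card-empty n
  where card-empty : ∀ n → card (segment {n} zero zero) ≡ 0
        card-empty zero    = refl
        card-empty (suc n) = card-empty n
card-segment {suc n} zero    (suc w) (s≤s w≤n)   = cong suc (card-segment zero w w≤n)
card-segment {suc n} (suc l) w       (s≤s l+w≤n) = card-segment l w l+w≤n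

nonempty⁻ : (S : Subset n) → T (nonemptyᵇ S) → ∃[ i ] i ∈ˢ S
nonempty⁻ {n} S p = Any.satisfied (any⁻ (lookup S) (allFin n) p)

nonempty⁺ : (S : Subset n) (i : Fin n) → i ∈ˢ S → T (nonemptyᵇ S)
nonempty⁺ S i p = any⁺ (lookup S) (lose (∈-allFin i) p)

least greatest : Subset n → ℕ
least []          = 0
least (true ∷ S)  = 0
least (false ∷ S) = suc (least S)

greatest []      = 0
greatest (b ∷ S) = if nonemptyᵇ S then suc (greatest S) else 0

least≤ : (S : Subset n) (i : Fin n) → i ∈ˢ S → least S ≤ toℕ i
least≤ (true ∷ S)  i        _ = z≤n
least≤ (false ∷ S) (fsuc i) p = s≤s (least≤ S i p)

least-∈ : (S : Subset n) (i : Fin n) → i ∈ˢ S → ∃[ j ] j ∈ˢ S × toℕ j ≡ least S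
least-∈ (true ∷ S)  i        _ = fzero , tt , refl
least-∈ (false ∷ S) (fsuc i) p = let j , q , e = least-∈ S i p in fsuc j , q , cong suc e

≤greatest : (S : Subset n) (i : Fin n) → i ∈ˢ S → toℕ i ≤ greatest S
≤greatest (b ∷ S) fzero    _ = z≤n
≤greatest (b ∷ S) (fsuc i) p with nonemptyᵇ S | nonempty⁺ S i p
... | true | _ = s≤s (≤greatest S i p)

greatest-∈ : (S : Subset n) (i : Fin n) → i ∈ˢ S → ∃[ j ] j ∈ˢ S × toℕ j ≡ greatest S
greatest-∈ (b ∷ S) i p with nonemptyᵇ S in eq
... | true  = let k , q = nonempty⁻ S (subst T (sym eq) tt)
                  j , r , e = greatest-∈ S k q
              in fsuc j , r , cong suc e
greatest-∈ (b ∷ S) fzero    p | false = fzero , p , refl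
greatest-∈ (b ∷ S) (fsuc i) p | false = ⊥-elim (subst T eq (nonempty⁺ S i p))

card≤extent : (S : Subset n) → T (nonemptyᵇ S) → card S ≤ suc (greatest S) ∸ least S
card≤extent {n} S ne with nonempty⁻ S ne
... | i , i∈S = ≤-trans (card-mono S (segment l (suc g ∸ l)) S⊆segment)
                        (≤-reflexive (card-segment l (suc g ∸ l) (≤-trans (≤-reflexive (m+[n∸m]≡n l≤1+g)) g<n)))
  where
  l = least S
  g = greatest S
  l≤1+g : l ≤ suc g
  l≤1+g = m≤n⇒m≤1+n (≤-trans (least≤ S i i∈S) (≤greatest S i i∈S))
  g<n : g < n
  g<n = let j , _ , j≡g = greatest-∈ S i i∈S in subst (_< n) j≡g (toℕ<n j)
  S⊆segment : ∀ j → j ∈ˢ S → j ∈ˢ segment l (suc g ∸ l)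
  S⊆segment j j∈S = ∈-segment⁺ l (suc g ∸ l) j (least≤ S j j∈S)
                      (subst (toℕ j <_) (sym (m+[n∸m]≡n l≤1+g)) (s≤s (≤greatest S j j∈S)))

and⁻ : ∀ bs → T (and bs) → All T bs
and⁻ []           _ = []
and⁻ (true ∷ bs)  p = tt ∷ and⁻ bs p

and⁺ : ∀ {bs} → All T bs → T (and bs)
and⁺ {[]}         []       = tt
and⁺ {true ∷ bs}  (_ ∷ ps) = and⁺ ps

module _ (r : ℕ → ℕ → Bool) (S S′ : Subset n) where

  private
    related : Fin n → Fin n → Bool
    related a b = not (lookup S a ∧ lookup S′ b) ∨ r (toℕ a) (toℕ b)

  -- maxLeMinᵇ and maxLtMinᵇ are Pairwiseᵇ _≤ᵇ_ and Pairwiseᵇ _<ᵇ_, definitionally.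
  Pairwiseᵇ : Bool
  Pairwiseᵇ = and (concatMap (λ a → map (related a) (allFin n)) (allFin n))

  pairwise⁻ : T Pairwiseᵇ → ∀ a b → a ∈ˢ S → b ∈ˢ S′ → T (r (toℕ a) (toℕ b))
  pairwise⁻ p a b a∈S b∈S′ = implication (lookup S a) (lookup S′ b) _ a∈S b∈S′
    (All.tabulate⁻ (All.map⁻ (All.tabulate⁻ (All.map⁻ (All.concat⁻ (and⁻ _ p))) a)) b)
    where
    implication : ∀ x y z → T x → T y → T (not (x ∧ y) ∨ z) → T z
    implication true true z _ _ p = p

  pairwise⁺ : (∀ a b → a ∈ˢ S → b ∈ˢ S′ → T (r (toℕ a) (toℕ b))) → T Pairwiseᵇ
  pairwise⁺ h = and⁺ (All.concat⁺ (All.map⁺ (All.tabulate⁺ λ a → All.map⁺ (All.tabulate⁺ λ b →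
    implication (lookup S a) (lookup S′ b) _ (h a b)))))
    where
    implication : ∀ x y z → (T x → T y → T z) → T (not (x ∧ y) ∨ z)
    implication true  true  z h = h tt tt
    implication true  false z h = tt
    implication false y     z h = tt

extremes-related : (r : ℕ → ℕ → Bool) (S S′ : Subset n) → T (nonemptyᵇ S) → T (nonemptyᵇ S′) →
                   T (Pairwiseᵇ r S S′) → T (r (greatest S) (least S′))
extremes-related r S S′ ne ne′ p with nonempty⁻ S ne | nonempty⁻ S′ ne′
... | i , i∈S | i′ , i′∈S′ =
  let a , a∈S , a≡g = greatest-∈ S i i∈S
      b , b∈S′ , b≡l = least-∈ S′ i′ i′∈S′
  in subst₂ (λ x y → T (r x y)) a≡g b≡l (pairwise⁻ r S S′ p a b a∈S b∈S′)

-- Strict partitions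

-- the largest strict partition contained in λ′ with parts at most cap
greedy : ℕ → List ℕ → List ℕ
greedy cap []       = []
greedy cap (x ∷ λ′) with x ⊓ cap
... | zero  = []
... | suc y = suc y ∷ greedy y λ′

greedy-bounded : ∀ cap λ′ → All (_≤ cap) (greedy cap λ′)
greedy-bounded cap []       = []
greedy-bounded cap (x ∷ λ′) with x ⊓ cap | m⊓n≤n x cap
... | zero  | _        = []
... | suc y | 1+y≤cap = 1+y≤cap ∷ All.map (λ z≤y → ≤-trans z≤y (≤-trans (n≤1+n y) 1+y≤cap)) (greedy-bounded y λ′)

greedy-strict : ∀ cap λ′ → IsStrictPartition (greedy cap λ′)
greedy-strict cap []       = [] , []
greedy-strict cap (x ∷ λ′) with x ⊓ cap
... | zero  = [] , []
... | suc y = let positive , decreasing = greedy-strict y λ′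
              in s≤s z≤n ∷ positive , below (greedy y λ′) decreasing (greedy-bounded y λ′)
  where
  below : ∀ μ → Linked _>_ μ → All (_≤ y) μ → Linked _>_ (suc y ∷ μ)
  below []      _ _         = [-]
  below (z ∷ μ) d (z≤y ∷ _) = s≤s z≤y ∷ d

greedy-⊆ : ∀ cap λ′ → greedy cap λ′ ⊆ₚ λ′
greedy-⊆ cap []       i = z≤n
greedy-⊆ cap (x ∷ λ′) i with x ⊓ cap | m⊓n≤m x cap
... | zero  | _ = z≤n
greedy-⊆ cap (x ∷ λ′) zero    | suc y | 1+y≤x = 1+y≤x
greedy-⊆ cap (x ∷ λ′) (suc i) | suc y | _     = greedy-⊆ y λ′ i

length-greedy≤ : ∀ cap λ′ → length (greedy cap λ′) ≤ length λ′
length-greedy≤ cap []       = z≤n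
length-greedy≤ cap (x ∷ λ′) with x ⊓ cap
... | zero  = z≤n
... | suc y = s≤s (length-greedy≤ y λ′)

greedy-maximal : ∀ cap λ′ ν → IsStrictPartition ν → ν ⊆ₚ λ′ → part ν 0 ≤ cap →
                 ∀ i → part ν i ≤ part (greedy cap λ′) i
greedy-maximal cap λ′       []      _ _ _ i = z≤n
greedy-maximal cap []       (v ∷ ν) _ ν⊆λ _ i = ν⊆λ i
greedy-maximal cap (x ∷ λ′) (v ∷ ν) (v>0 ∷ ν>0 , decreasing) ν⊆λ v≤cap i
  with x ⊓ cap | ⊓-glb (ν⊆λ 0) v≤cap
... | zero  | v≤0 = ⊥-elim (<⇒≱ v>0 v≤0)
greedy-maximal cap (x ∷ λ′) (v ∷ ν) _ _ _ zero | suc y | v≤1+y = v≤1+y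
greedy-maximal cap (x ∷ λ′) (v ∷ ν) (_ ∷ ν>0 , decreasing) ν⊆λ _ (suc i) | suc y | v≤1+y =
  greedy-maximal y λ′ ν (ν>0 , Linked.tail decreasing) (λ j → ν⊆λ (suc j)) (head≤y ν decreasing) i
  where
  head≤y : ∀ ν → Linked _>_ (v ∷ ν) → part ν 0 ≤ y
  head≤y []      _           = z≤n
  head≤y (w ∷ ν) (w<v ∷ _) = ≤-pred (≤-trans w<v v≤1+y)

size-mono : ∀ ν μ → (∀ i → part ν i ≤ part μ i) → size ν ≤ size μ
size-mono []      μ       _ = z≤n
size-mono (v ∷ ν) []      h = ≤-trans (≤-reflexive (cong (_+ size ν) (n≤0⇒n≡0 (h 0)))) (size-mono ν [] (λ i → h (suc i)))
size-mono (v ∷ ν) (m ∷ μ) h = +-mono-≤ (h 0) (size-mono ν μ (λ i → h (suc i)))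

≤-pointwise-size⇒≡ : ∀ ν μ → All (0 <_) ν → All (0 <_) μ → (∀ i → part ν i ≤ part μ i) → size μ ≤ size ν → ν ≡ μ
≤-pointwise-size⇒≡ []      []      _ _ _ _ = refl
≤-pointwise-size⇒≡ []      (m ∷ μ) _ (m>0 ∷ _) _ size≤ = ⊥-elim (<⇒≱ (<-≤-trans m>0 (m≤m+n m (size μ))) size≤)
≤-pointwise-size⇒≡ (v ∷ ν) []      (v>0 ∷ _) _ h _ = ⊥-elim (<⇒≱ v>0 (h 0))
≤-pointwise-size⇒≡ (v ∷ ν) (m ∷ μ) (_ ∷ ν>0) (_ ∷ μ>0) h size≤ =
  cong₂ _∷_ v≡m (≤-pointwise-size⇒≡ ν μ ν>0 μ>0 (λ i → h (suc i)) tail-size≤)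
  where
  tail≤ = size-mono ν μ (λ i → h (suc i))
  v≡m : v ≡ m
  v≡m = ≤-antisym (h 0) (+-cancelʳ-≤ (size μ) m v (≤-trans size≤ (+-monoʳ-≤ v tail≤)))
  tail-size≤ : size μ ≤ size ν
  tail-size≤ = +-cancelˡ-≤ m (size μ) (size ν) (subst (λ u → m + size μ ≤ u + size ν) v≡m size≤)

largest≡greedy : ∀ λ′ μ → IsLargestStrictIn μ λ′ → μ ≡ greedy (part λ′ 0) λ′
largest≡greedy λ′ μ (μ-strict@(μ>0 , _) , μ⊆λ , largest) =
  ≤-pointwise-size⇒≡ μ (greedy cap λ′) μ>0 g>0 (greedy-maximal cap λ′ μ μ-strict μ⊆λ (μ⊆λ 0))
                     (largest (greedy cap λ′) g-strict (greedy-⊆ cap λ′))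
  where
  cap = part λ′ 0
  g-strict = greedy-strict cap λ′
  g>0 = proj₁ g-strict

-- Σᵢ (μᵢ + n ∸ (a + i + 1)), summing the largest possible width of each hook
hookBound : ℕ → ℕ → List ℕ → ℕ
hookBound n a []      = 0
hookBound n a (m ∷ μ) = m + (n ∸ suc a) + hookBound n (suc a) μ

triangle : ℕ → ℕ
triangle zero    = 0
triangle (suc ℓ) = suc ℓ + triangle ℓ

triangle-half : ∀ ℓ → ℓ * suc ℓ / 2 ≡ triangle ℓ
triangle-half ℓ = trans (cong (_/ 2) (twice ℓ)) (m*n/n≡m (triangle ℓ) 2)
  where
  twice : ∀ ℓ → ℓ * suc ℓ ≡ triangle ℓ * 2
  twice zero    = refl
  twice (suc ℓ) = begin
    suc ℓ * suc (suc ℓ)          ≡⟨ expand ℓ ⟩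
    suc ℓ * 2 + ℓ * suc ℓ        ≡⟨ cong (suc ℓ * 2 +_) (twice ℓ) ⟩
    suc ℓ * 2 + triangle ℓ * 2   ≡⟨ *-distribʳ-+ 2 (suc ℓ) (triangle ℓ) ⟨
    (suc ℓ + triangle ℓ) * 2     ∎
    where
    open ≡-Reasoning
    expand : ∀ ℓ → suc ℓ * suc (suc ℓ) ≡ suc ℓ * 2 + ℓ * suc ℓ
    expand = solve-∀

hookBound-closed : ∀ n a μ → a + length μ ≤ n →
                   hookBound n a μ + length μ * a + triangle (length μ) ≡ size μ + length μ * n
hookBound-closed n a []      _        = refl
hookBound-closed n a (m ∷ μ) a+ℓ+1≤n = begin
  m + u + H + suc ℓ * a + (suc ℓ + triangle ℓ)  ≡⟨ regroup m u H ℓ a (triangle ℓ) ⟩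
  m + (u + suc a) + (H + ℓ * suc a + triangle ℓ) ≡⟨ cong₂ (λ x y → m + x + y) (m∸n+n≡m 1+a≤n) ih ⟩
  m + n + (size μ + ℓ * n)                       ≡⟨ regroup′ m n (size μ) ℓ ⟩
  m + size μ + suc ℓ * n                         ∎
  where
  open ≡-Reasoning
  ℓ = length μ
  u = n ∸ suc a
  H = hookBound n (suc a) μ
  1+a+ℓ≤n : suc a + ℓ ≤ n
  1+a+ℓ≤n = subst (_≤ n) (+-suc a ℓ) a+ℓ+1≤n
  1+a≤n : suc a ≤ n
  1+a≤n = ≤-trans (m≤m+n (suc a) ℓ) 1+a+ℓ≤n
  ih = hookBound-closed n (suc a) μ 1+a+ℓ≤n
  regroup : ∀ m u H ℓ a t → m + u + H + suc ℓ * a + (suc ℓ + t) ≡ m + (u + suc a) + (H + ℓ * suc a + t)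
  regroup = solve-∀
  regroup′ : ∀ m n s ℓ → m + n + (s + ℓ * n) ≡ m + s + suc ℓ * n
  regroup′ = solve-∀

hookBound≡formula : ∀ n μ → length μ ≤ n →
                    hookBound n 0 μ ≡ size μ + length μ * n ∸ length μ * suc (length μ) / 2
hookBound≡formula n μ ℓ≤n = sym (begin
  size μ + ℓ * n ∸ ℓ * suc ℓ / 2           ≡⟨ cong₂ _∸_ (sym (hookBound-closed n 0 μ ℓ≤n)) (triangle-half ℓ) ⟩
  hookBound n 0 μ + ℓ * 0 + t ∸ t          ≡⟨ m+n∸n≡m (hookBound n 0 μ + ℓ * 0) t ⟩
  hookBound n 0 μ + ℓ * 0                  ≡⟨ cong (hookBound n 0 μ +_) (*-zeroʳ ℓ) ⟩
  hookBound n 0 μ + 0                      ≡⟨ +-identityʳ _ ⟩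
  hookBound n 0 μ                          ∎)
  where
  open ≡-Reasoning
  ℓ = length μ
  t = triangle ℓ

-- Interval tableaux

Interval : Set
Interval = ℕ × ℕ

lo hi width : Interval → ℕ
lo    = proj₁
hi    = proj₂
width b = suc (hi b) ∸ lo b

_≤ᴵ_ _<ᴵ_ : Interval → Interval → Set
b ≤ᴵ c = hi b ≤ lo c
b <ᴵ c = hi b < lo c

Proper : ℕ → Interval → Set
Proper n b = lo b ≤ hi b × hi b < n

ColumnStrict : List Interval → List Interval → Set
ColumnStrict (b ∷ l) (c ∷ u) = b <ᴵ c × ColumnStrict l u
ColumnStrict _       _       = ⊤

-- The rows are listed bottom row first, as for fillings.
record IntervalTableau (n : ℕ) (P : List (List Interval)) : Set where
  field
    proper     : All (All (Proper n)) P
    rows       : All (Linked _≤ᴵ_) P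
    columns    : Linked ColumnStrict P
    decreasing : Linked _≥_ (map length P)

open IntervalTableau

tableau-tail : ∀ {r P} → IntervalTableau n (r ∷ P) → IntervalTableau n P
tableau-tail t = record
  { proper = All.tail (proper t) ; rows = All.tail (rows t)
  ; columns = Linked.tail (columns t) ; decreasing = Linked.tail (decreasing t) }

AtLeast : ℕ → List (List Interval) → Set
AtLeast a = All (All (λ b → a ≤ lo b))

rowWeight : List Interval → ℕ
rowWeight r = sum (map width r)

weight : List (List Interval) → ℕ
weight P = sum (map rowWeight P)

width+lo : ∀ b → lo b ≤ hi b → width b + lo b ≡ suc (hi b)
width+lo b lo≤hi = m∸n+n≡m (m≤n⇒m≤1+n lo≤hi)

rowWeight-++ : ∀ r r′ → rowWeight (r ++ r′) ≡ rowWeight r + rowWeight r′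
rowWeight-++ r r′ = trans (cong sum (List.map-++ width r r′)) (sum-++ (map width r) (map width r′))

weight-take-drop : ∀ k P → weight P ≡ weight (map (take k) P) + weight (map (drop k) P)
weight-take-drop k []      = refl
weight-take-drop k (r ∷ P) = begin
  rowWeight r + weight P
    ≡⟨ cong₂ _+_ (trans (cong rowWeight (sym (List.take++drop≡id k r))) (rowWeight-++ (take k r) (drop k r)))
                 (weight-take-drop k P) ⟩
  rowWeight (take k r) + rowWeight (drop k r) + (weight (map (take k) P) + weight (map (drop k) P))
    ≡⟨ +-interchange (rowWeight (take k r)) (rowWeight (drop k r)) (weight (map (take k) P)) (weight (map (drop k) P)) ⟩
  rowWeight (take k r) + weight (map (take k) P) + (rowWeight (drop k r) + weight (map (drop k) P)) ∎
  where open ≡-Reasoning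

linked-take : ∀ {A : Set} {R : A → A → Set} k {r} → Linked R r → Linked R (take k r)
linked-take zero          _           = []
linked-take (suc k)       []          = []
linked-take (suc zero)    [-]         = [-]
linked-take (suc (suc k)) [-]         = [-]
linked-take (suc zero)    (_ ∷ _)     = [-]
linked-take (suc (suc k)) (Rxy ∷ Rxs) = Rxy ∷ linked-take (suc k) Rxs

columnStrict-take : ∀ k l u → ColumnStrict l u → ColumnStrict (take k l) (take k u)
columnStrict-take zero    l       u       _        = tt
columnStrict-take (suc k) []      u       _        = tt
columnStrict-take (suc k) (b ∷ l) []      _        = tt
columnStrict-take (suc k) (b ∷ l) (c ∷ u) (b<c , s) = b<c , columnStrict-take k l u s

columnStrict-[]ʳ : ∀ l → ColumnStrict l []
columnStrict-[]ʳ []      = tt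
columnStrict-[]ʳ (_ ∷ _) = tt

columnStrict-drop : ∀ k l u → ColumnStrict l u → ColumnStrict (drop k l) (drop k u)
columnStrict-drop zero    l       u       s       = s
columnStrict-drop (suc k) []      u       _       = tt
columnStrict-drop (suc k) (b ∷ l) []      _       = columnStrict-[]ʳ (drop k l)
columnStrict-drop (suc k) (b ∷ l) (c ∷ u) (_ , s) = columnStrict-drop k l u s

truncate : ∀ k {P} → IntervalTableau n P → IntervalTableau n (map (take k) P)
truncate k {P} t = record
  { proper     = All.map⁺ (All.map (All.take⁺ k) (proper t))
  ; rows       = All.map⁺ (All.map (linked-take k) (rows t))
  ; columns    = Linked.map⁺ (Linked.map (λ {l} {u} → columnStrict-take k l u) (columns t))
  ; decreasing = Linked.map⁺ {f = length} (Linked.map⁺ {f = take k}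
                   (Linked.map (λ {r} {q} → take-length-mono r q) (Linked.map⁻ {f = length} (decreasing t))))
  }
  where
  take-length-mono : ∀ r q → length r ≥ length q → length (take k r) ≥ length (take k q)
  take-length-mono r q q≤r = subst₂ _≥_ (sym (List.length-take k r)) (sym (List.length-take k q)) (⊓-monoʳ-≤ k q≤r)

linked-≥⇒All≤ : ∀ {x xs} → Linked _≥_ (x ∷ xs) → All (_≤ x) xs
linked-≥⇒All≤ d = All.tail (Linked.Linked⇒All (λ y≤x z≤y → ≤-trans z≤y y≤x) ≤-refl d)

last-of : ∀ {A : Set} → A → List A → A
last-of b []      = b
last-of _ (c ∷ r) = last-of c r

drop-last-of : ∀ {A : Set} (b : A) r → drop (length r) (b ∷ r) ≡ last-of b r ∷ []
drop-last-of b []      = refl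
drop-last-of b (c ∷ r) = drop-last-of c r

-- The widths along a row telescope, since each interval starts where the previous one ends.
telescope : ∀ b r → Linked _≤ᴵ_ (b ∷ r) → All (λ c → lo c ≤ hi c) (b ∷ r) →
            rowWeight (b ∷ r) + lo b ≤ length (b ∷ r) + hi (last-of b r)
telescope b []      _           (lo≤hi ∷ _) = ≤-reflexive (trans (cong (_+ lo b) (+-identityʳ (width b))) (width+lo b lo≤hi))
telescope b (c ∷ r) (b≤c ∷ row) (lo≤hi ∷ ps) = begin
  width b + rowWeight (c ∷ r) + lo b   ≡⟨ +-right-comm (width b) (rowWeight (c ∷ r)) (lo b) ⟩
  width b + lo b + rowWeight (c ∷ r)   ≡⟨ cong (_+ rowWeight (c ∷ r)) (width+lo b lo≤hi) ⟩
  suc (hi b) + rowWeight (c ∷ r)       ≤⟨ +-monoˡ-≤ (rowWeight (c ∷ r)) (s≤s b≤c) ⟩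
  suc (lo c) + rowWeight (c ∷ r)       ≡⟨ cong suc (+-comm (lo c) (rowWeight (c ∷ r))) ⟩
  suc (rowWeight (c ∷ r) + lo c)       ≤⟨ s≤s (telescope c r row ps) ⟩
  suc (length (c ∷ r) + hi (last-of c r)) ∎
  where open ≤-Reasoning

weight-drop-short : ∀ k Q → All (λ q → length q ≤ k) Q → weight (map (drop k) Q) ≡ 0
weight-drop-short k []      _             = refl
weight-drop-short k (q ∷ Q) (q≤k ∷ short) rewrite List.drop-all k q q≤k = weight-drop-short k Q short

-- A column climbs strictly from z, so z's upper end plus the widths above it stay below n.
column-bound : ∀ k z p Q → drop k p ≡ z ∷ [] → hi z < n →
               All (All (Proper n)) Q → Linked ColumnStrict (p ∷ Q) → Linked _≥_ (map length (p ∷ Q)) →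
               hi z + weight (map (drop k) Q) < n
column-bound {n} k z p [] _ z<n _ _ _ = subst (_< n) (sym (+-identityʳ (hi z))) z<n
column-bound {n} k z p (q ∷ Q) p-end z<n (q-proper ∷ Q-proper) (p<q ∷ columns) (q≤p ∷ lengths)
  with drop k q in q-end
... | [] = subst (_< n) (sym (trans (cong (hi z +_) (weight-drop-short k Q Q-short)) (+-identityʳ (hi z)))) z<n
  where
  q≤k : length q ≤ k
  q≤k = m∸n≡0⇒m≤n (trans (sym (List.length-drop k q)) (cong length q-end))
  Q-short : All (λ q′ → length q′ ≤ k) Q
  Q-short = All.map⁻ (All.map (λ q′≤q → ≤-trans q′≤q q≤k) (linked-≥⇒All≤ lengths))
... | z′ ∷ [] = begin-strict
  hi z + (width z′ + 0 + weight (map (drop k) Q)) ≡⟨ cong (λ x → hi z + (x + weight (map (drop k) Q))) (+-identityʳ (width z′)) ⟩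
  hi z + (width z′ + weight (map (drop k) Q))     ≡⟨ +-assoc (hi z) (width z′) _ ⟨
  hi z + width z′ + weight (map (drop k) Q)       ≤⟨ +-monoˡ-≤ (weight (map (drop k) Q)) z+z′≤z′ ⟩
  hi z′ + weight (map (drop k) Q)                 <⟨ column-bound k z′ q Q q-end (proj₂ z′-proper) Q-proper columns lengths ⟩
  n                                               ∎
  where
  open ≤-Reasoning
  z<z′ : z <ᴵ z′
  z<z′ = proj₁ (subst₂ ColumnStrict p-end q-end (columnStrict-drop k p q p<q))
  z′-proper : Proper n z′
  z′-proper = All.head (subst (All (Proper n)) q-end (All.drop⁺ k q-proper))
  z+z′≤z′ : hi z + width z′ ≤ hi z′
  z+z′≤z′ = +-cancelʳ-≤ (lo z′) _ _ (begin
    hi z + width z′ + lo z′   ≡⟨ +-assoc (hi z) (width z′) (lo z′) ⟩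
    hi z + (width z′ + lo z′) ≡⟨ cong (hi z +_) (width+lo z′ (proj₁ z′-proper)) ⟩
    hi z + suc (hi z′)        ≡⟨ +-suc (hi z) (hi z′) ⟩
    suc (hi z) + hi z′        ≤⟨ +-monoˡ-≤ (hi z′) z<z′ ⟩
    lo z′ + hi z′             ≡⟨ +-comm (lo z′) (hi z′) ⟩
    hi z′ + lo z′             ∎)
... | _ ∷ _ ∷ _
  with s≤s () ← subst₂ (λ u v → length u ≤ length v) q-end p-end
              (subst₂ _≤_ (sym (List.length-drop k q)) (sym (List.length-drop k p)) (∸-monoˡ-≤ k q≤p))

-- A column of c + 1 boxes starting at z climbs by at least one per box and stays below n.
column-top : ∀ {n} k z zs r Q c → All (All (Proper n)) (r ∷ Q) → Linked ColumnStrict (r ∷ Q) →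
             drop k r ≡ z ∷ zs → c ≤ length Q → All (λ q → k < length q) (take c Q) → hi z + c < n
column-top {n} k z zs r Q zero (p ∷ _) _ r-end _ _ =
  subst (_< n) (sym (+-identityʳ (hi z))) (proj₂ (All.head (subst (All (Proper n)) r-end (All.drop⁺ k p))))
column-top {n} k z zs r (q ∷ Q) (suc c) (p ∷ ps) (r<q ∷ columns) r-end (s≤s c≤) (k<q ∷ long) with drop k q in q-end
... | [] with () ← subst (_≤ 0) (m+n∸n≡m 1 k)
                     (subst (suc k ∸ k ≤_) (trans (sym (List.length-drop k q)) (cong length q-end)) (∸-monoˡ-≤ k k<q))
... | z′ ∷ zs′ = begin-strict
  hi z + suc c   ≡⟨ +-suc (hi z) c ⟩
  suc (hi z) + c ≤⟨ +-monoˡ-≤ c (≤-trans z<z′ (proj₁ z′-proper)) ⟩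
  hi z′ + c      <⟨ column-top k z′ zs′ q Q c ps columns q-end c≤ long ⟩
  n              ∎
  where
  open ≤-Reasoning
  z<z′ : z <ᴵ z′
  z<z′ = proj₁ (subst₂ ColumnStrict r-end q-end (columnStrict-drop k r q r<q))
  z′-proper : Proper n z′
  z′-proper = All.head (subst (All (Proper n)) q-end (All.drop⁺ k (All.head ps)))

atLeast-next-row : ∀ a r q → ColumnStrict r q → length q ≤ length r → All (Proper n) r →
                   All (λ b → a ≤ lo b) r → All (λ b → suc a ≤ lo b) q
atLeast-next-row a r       []      _         _         _        _          = []
atLeast-next-row a (b ∷ r) (c ∷ q) (b<c , s) (s≤s q≤r) (p ∷ ps) (a≤b ∷ as) =
  ≤-trans (s≤s (≤-trans a≤b (proj₁ p))) b<c ∷ atLeast-next-row a r q s q≤r ps as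

atLeast-above : ∀ a r P → IntervalTableau n (r ∷ P) → All (λ b → a ≤ lo b) r → AtLeast (suc a) P
atLeast-above a r []      _ _   = []
atLeast-above a r (q ∷ P) t a≤r = a<q ∷ All.map (All.map (≤-trans (n≤1+n (suc a)))) (atLeast-above (suc a) q P (tableau-tail t) a<q)
  where
  a<q = atLeast-next-row a r q (Linked.head (columns t)) (Linked.head (decreasing t)) (All.head (proper t)) a≤r

-- A hook: a whole row together with the column above its last box.
hook-bound : ∀ a y R Q → IntervalTableau n (R ∷ Q) → length R ≡ suc y → All (λ b → a ≤ lo b) R →
             rowWeight R + weight (map (drop y) Q) + a ≤ y + n
hook-bound {n} a _ (b ∷ r) Q t refl (a≤b ∷ _) = begin
  rowWeight (b ∷ r) + W + a            ≤⟨ +-monoʳ-≤ (rowWeight (b ∷ r) + W) a≤b ⟩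
  rowWeight (b ∷ r) + W + lo b         ≡⟨ +-right-comm (rowWeight (b ∷ r)) W (lo b) ⟩
  rowWeight (b ∷ r) + lo b + W         ≤⟨ +-monoˡ-≤ W (telescope b r (All.head (rows t)) (All.map proj₁ b∷r-proper)) ⟩
  suc (length r) + hi z + W            ≡⟨ +-assoc (suc (length r)) (hi z) W ⟩
  suc (length r) + (hi z + W)          ≡⟨ +-suc (length r) (hi z + W) ⟨
  length r + suc (hi z + W)            ≤⟨ +-monoʳ-≤ (length r) column ⟩
  length r + n                         ∎
  where
  open ≤-Reasoning
  W = weight (map (drop (length r)) Q)
  z = last-of b r
  b∷r-proper = All.head (proper t)
  column : hi z + W < n
  column = column-bound (length r) z (b ∷ r) Q (drop-last-of b r)
             (proj₂ (All.head (subst (All (Proper n)) (drop-last-of b r) (All.drop⁺ (length r) b∷r-proper))))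
             (All.tail (proper t)) (columns t) (decreasing t)

weight-all-empty : ∀ Rs → All (_≡ []) Rs → weight Rs ≡ 0
weight-all-empty []       []         = refl
weight-all-empty (_ ∷ Rs) (refl ∷ e) = weight-all-empty Rs e

take-⊓≡0 : ∀ cap (q : List Interval) → length q ⊓ cap ≡ 0 → take cap q ≡ []
take-⊓≡0 zero    q       _ = refl
take-⊓≡0 (suc c) []      _ = refl

-- Peel off the hook of the bottom row; the rows above, cut to the columns left of that hook, have entries ≥ a + 1.
weight-bound : ∀ cap a P → IntervalTableau n P → AtLeast a P →
               weight (map (take cap) P) ≤ hookBound n a (greedy cap (map length P))
weight-bound cap a []      _ _           = z≤n
weight-bound {n} cap a (r ∷ P) t (a≤r ∷ _) with length r ⊓ cap in r⊓cap
... | zero = ≤-reflexive (weight-all-empty (map (take cap) (r ∷ P))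
               (All.map⁺ (All.map (λ {q} q≤r → take-⊓≡0 cap q (n≤0⇒n≡0 (≤-trans (⊓-monoˡ-≤ cap q≤r) (≤-reflexive r⊓cap))))
                                   (≤-refl ∷ All.map⁻ (linked-≥⇒All≤ (decreasing t))))))
... | suc y = begin
  rowWeight R + weight Q                                              ≡⟨ cong (rowWeight R +_) (weight-take-drop y Q) ⟩
  rowWeight R + (weight (map (take y) Q) + weight (map (drop y) Q))   ≡⟨ cong (λ X → rowWeight R + (weight X + weight (map (drop y) Q))) take-y-Q ⟩
  rowWeight R + (weight (map (take y) P) + weight (map (drop y) Q))   ≡⟨ cong (rowWeight R +_) (+-comm (weight (map (take y) P)) _) ⟩
  rowWeight R + (weight (map (drop y) Q) + weight (map (take y) P))   ≡⟨ +-assoc (rowWeight R) _ _ ⟨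
  rowWeight R + weight (map (drop y) Q) + weight (map (take y) P)     ≤⟨ +-mono-≤ hook rest ⟩
  suc y + (n ∸ suc a) + hookBound n (suc a) (greedy y (map length P)) ∎
  where
  open ≤-Reasoning
  R = take cap r
  Q = map (take cap) P
  y<cap : suc y ≤ cap
  y<cap = subst (_≤ cap) r⊓cap (m⊓n≤n (length r) cap)
  take-y-Q : map (take y) Q ≡ map (take y) P
  take-y-Q = trans (sym (List.map-∘ P)) (List.map-cong (λ q → trans (List.take-take y cap q)
                                                                  (cong (λ k → take k q) (m≤n⇒m⊓n≡m (≤-trans (n≤1+n y) y<cap)))) P)
  shift : ∀ X → X + a ≤ y + n → X ≤ suc y + (n ∸ suc a)
  shift X X+a≤ = +-cancelʳ-≤ a X _ (≤-trans X+a≤ (≤-trans (+-monoʳ-≤ y (m≤n+m∸n n (suc a))) (≤-reflexive (regroup y a (n ∸ suc a)))))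
    where regroup : ∀ y a u → y + (suc a + u) ≡ suc y + u + a
          regroup = solve-∀
  hook : rowWeight R + weight (map (drop y) Q) ≤ suc y + (n ∸ suc a)
  hook = shift _ (hook-bound a y R Q (truncate cap t) (trans (List.length-take cap r) (trans (⊓-comm cap (length r)) r⊓cap))
                             (All.take⁺ cap a≤r))
  rest = weight-bound y (suc a) P (tableau-tail t) (atLeast-above a r P t a≤r)

-- An interval tableau of largest weight

leading : ℕ → List ℕ → ℕ
leading s []       = 0
leading s (x ∷ λ′) with s ≤? x
... | yes _ = suc (leading s λ′)
... | no  _ = 0

leading≤length : ∀ s λ′ → leading s λ′ ≤ length λ′
leading≤length s []       = z≤n
leading≤length s (x ∷ λ′) with s ≤? x
... | yes _ = s≤s (leading≤length s λ′)
... | no  _ = z≤n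

leading-fits : ∀ {n} a s x λ′ → a + length (x ∷ λ′) ≤ n → a + suc (leading s λ′) ≤ n
leading-fits a s x λ′ a+ℓ≤n = ≤-trans (+-monoʳ-≤ a (s≤s (leading≤length s λ′))) a+ℓ≤n

leading-≥ : ∀ s λ′ → All (s ≤_) (take (leading s λ′) λ′)
leading-≥ s []       = []
leading-≥ s (x ∷ λ′) with s ≤? x
... | yes s≤x = s≤x ∷ leading-≥ s λ′
... | no  _   = []

leading-< : ∀ s λ′ → Linked _≥_ λ′ → All (_< s) (drop (leading s λ′) λ′)
leading-< s []       _ = []
leading-< s (x ∷ λ′) d with s ≤? x
... | yes _   = leading-< s λ′ (Linked.tail d)
... | no  s≰x = ≰⇒> s≰x ∷ All.map (λ y≤x → ≤-<-trans y≤x (≰⇒> s≰x)) (linked-≥⇒All≤ d)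

stack : ℕ → ℕ → List (List Interval) → List (List Interval)
stack zero    v rows       = rows
stack (suc c) v []         = []
stack (suc c) v (r ∷ rows) = (r ++ [ suc v , suc v ]) ∷ stack c (suc v) rows

hookRow : ℕ → ℕ → ℕ → List Interval
hookRow y a v = replicate y (a , a) ++ [ a , v ]

-- The filling attaining hookBound: each hook is a row of a's ending in [a, v], topped by the column v + 1, …, n − 1.
extremal : ℕ → ℕ → ℕ → List ℕ → List (List Interval)
extremal n cap a []       = []
extremal n cap a (x ∷ λ′) with x ⊓ cap
... | zero  = [] ∷ map (λ _ → []) λ′
... | suc y = hookRow y a v ∷ stack h v (extremal n y (suc a) λ′)
  where
  h = leading (suc y) λ′
  v = n ∸ suc h

stack-base : ∀ a h n → a + suc h ≤ n → a ≤ n ∸ suc h × n ∸ suc h < n × suc (n ∸ suc h) + h ≡ n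
stack-base a h n a+h<n =
  m+n≤o⇒m≤o∸n a a+h<n ,
  ∸-monoʳ-< {n} {suc h} {0} (s≤s z≤n) 1+h≤n ,
  trans (sym (+-suc (n ∸ suc h) h)) (m∸n+n≡m 1+h≤n)
  where
  1+h≤n = ≤-trans (m≤n+m (suc h) a) a+h<n

⊓-capped : ∀ x cap λ′ → All (_≤ x) λ′ → map (_⊓ cap) λ′ ≡ map (_⊓ (x ⊓ cap)) λ′
⊓-capped x cap λ′ λ≤x = List.map-cong-local (All.map (λ {t} t≤x → trans (cong (_⊓ cap) (sym (m≤n⇒m⊓n≡m t≤x))) (⊓-assoc t x cap)) λ≤x)

stack-shape : ∀ y c v rows λ′ → map length rows ≡ map (_⊓ y) λ′ →
              All (suc y ≤_) (take c λ′) → All (_< suc y) (drop c λ′) → map length (stack c v rows) ≡ map (_⊓ suc y) λ′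
stack-shape y zero    v rows       λ′       lengths _ short =
  trans lengths (List.map-cong-local (All.map (λ {t} t≤y → trans (m≤n⇒m⊓n≡m (≤-pred t≤y)) (sym (m≤n⇒m⊓n≡m (m≤n⇒m≤1+n (≤-pred t≤y))))) short))
stack-shape y (suc c) v []         []       _       _ _ = refl
stack-shape y (suc c) v (r ∷ rows) (t ∷ λ′) lengths (y<t ∷ long) short =
  cong₂ _∷_ (begin
    length (r ++ [ suc v , suc v ]) ≡⟨ List.length-++ r ⟩
    length r + 1                    ≡⟨ cong (_+ 1) (List.∷-injectiveˡ lengths) ⟩
    t ⊓ y + 1                       ≡⟨ cong (_+ 1) (m≥n⇒m⊓n≡n (≤-pred (m≤n⇒m≤1+n y<t))) ⟩
    y + 1                           ≡⟨ +-comm y 1 ⟩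
    suc y                           ≡⟨ m≥n⇒m⊓n≡n y<t ⟨
    t ⊓ suc y                       ∎)
    (stack-shape y c (suc v) rows λ′ (List.∷-injectiveʳ lengths) long short)
  where open ≡-Reasoning

extremal-shape : ∀ n cap a λ′ → Linked _≥_ λ′ → map length (extremal n cap a λ′) ≡ map (_⊓ cap) λ′
extremal-shape n cap a []       _ = refl
extremal-shape n cap a (x ∷ λ′) d with x ⊓ cap | ⊓-capped x cap λ′ (linked-≥⇒All≤ d)
... | zero  | capped = cong (0 ∷_) (trans (sym (List.map-∘ λ′)) (trans (List.map-cong (λ t → sym (⊓-zeroʳ t)) λ′) (sym capped)))
... | suc y | capped = cong₂ _∷_ (trans (List.length-++ (replicate y (a , _))) (trans (cong (_+ 1) (List.length-replicate y)) (+-comm y 1)))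
  (trans (stack-shape y h v (extremal n y (suc a) λ′) λ′ (extremal-shape n y (suc a) λ′ (Linked.tail d))
                      (leading-≥ (suc y) λ′) (leading-< (suc y) λ′ (Linked.tail d)))
         (sym capped))
  where
  h = leading (suc y) λ′
  v = n ∸ suc h

length-stack : ∀ c v rows → length (stack c v rows) ≡ length rows
length-stack zero    v rows       = refl
length-stack (suc c) v []         = refl
length-stack (suc c) v (r ∷ rows) = cong suc (length-stack c (suc v) rows)

extremal-length : ∀ n cap a λ′ → length (extremal n cap a λ′) ≡ length λ′
extremal-length n cap a []       = refl
extremal-length n cap a (x ∷ λ′) with x ⊓ cap
... | zero  = cong suc (List.length-map _ λ′)
... | suc y = cong suc (trans (length-stack (leading (suc y) λ′) _ (extremal n y (suc a) λ′)) (extremal-length n y (suc a) λ′))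

weight-stack : ∀ c v rows → c ≤ length rows → weight (stack c v rows) ≡ weight rows + c
weight-stack zero    v rows       _         = sym (+-identityʳ (weight rows))
weight-stack (suc c) v (r ∷ rows) (s≤s c≤) = begin
  rowWeight (r ++ [ suc v , suc v ]) + weight (stack c (suc v) rows)
    ≡⟨ cong₂ _+_ (rowWeight-++ r _) (weight-stack c (suc v) rows c≤) ⟩
  rowWeight r + (width (suc v , suc v) + 0) + (weight rows + c)
    ≡⟨ cong (λ w → rowWeight r + (w + 0) + (weight rows + c)) (m+n∸n≡m 1 (suc v)) ⟩
  rowWeight r + 1 + (weight rows + c)
    ≡⟨ regroup (rowWeight r) (weight rows) c ⟩
  rowWeight r + weight rows + suc c ∎
  where
  open ≡-Reasoning
  regroup : ∀ r w c → r + 1 + (w + c) ≡ r + w + suc c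
  regroup = solve-∀

hook-arithmetic : ∀ y a h n B → a + suc h ≤ n → y + (suc (n ∸ suc h) ∸ a) + (B + h) ≡ suc y + (n ∸ suc a) + B
hook-arithmetic y a h n B a+h<n = begin
  y + (suc v ∸ a) + (B + h) ≡⟨ regroup y (suc v ∸ a) B h ⟩
  y + (suc v ∸ a + h) + B   ≡⟨ cong (λ u → y + u + B) (+-∸-comm h (m≤n⇒m≤1+n a≤v)) ⟨
  y + (suc v + h ∸ a) + B   ≡⟨ cong (λ u → y + (u ∸ a) + B) 1+v+h≡n ⟩
  y + (n ∸ a) + B           ≡⟨ cong (λ u → y + u + B) (+-∸-assoc 1 (≤-<-trans a≤v v<n)) ⟩
  y + suc (n ∸ suc a) + B   ≡⟨ cong (_+ B) (+-suc y (n ∸ suc a)) ⟩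
  suc y + (n ∸ suc a) + B   ∎
  where
  open ≡-Reasoning
  v = n ∸ suc h
  a≤v = proj₁ (stack-base a h n a+h<n)
  v<n = proj₁ (proj₂ (stack-base a h n a+h<n))
  1+v+h≡n = proj₂ (proj₂ (stack-base a h n a+h<n))
  regroup : ∀ y w B h → y + w + (B + h) ≡ y + (w + h) + B
  regroup = solve-∀

extremal-weight : ∀ n cap a λ′ → a + length λ′ ≤ n → weight (extremal n cap a λ′) ≡ hookBound n a (greedy cap λ′)
extremal-weight n cap a []       _ = refl
extremal-weight n cap a (x ∷ λ′) a+ℓ≤n with x ⊓ cap
... | zero  = weight-all-empty (map (λ _ → []) λ′) (All.map⁺ (All.universal (λ _ → refl) λ′))
... | suc y = begin
  rowWeight (hookRow y a v) + weight (stack h v E)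
    ≡⟨ cong₂ _+_ (trans (rowWeight-++ (replicate y (a , a)) [ a , v ]) (cong₂ _+_ (rowWeight-replicate y) (+-identityʳ _)))
                 (weight-stack h v E (subst (h ≤_) (sym (extremal-length n y (suc a) λ′)) (leading≤length (suc y) λ′))) ⟩
  y + (suc v ∸ a) + (weight E + h)
    ≡⟨ cong (λ B → y + (suc v ∸ a) + (B + h)) (extremal-weight n y (suc a) λ′ (subst (_≤ n) (+-suc a (length λ′)) a+ℓ≤n)) ⟩
  y + (suc v ∸ a) + (hookBound n (suc a) (greedy y λ′) + h)
    ≡⟨ hook-arithmetic y a h n _ (leading-fits a (suc y) x λ′ a+ℓ≤n) ⟩
  suc y + (n ∸ suc a) + hookBound n (suc a) (greedy y λ′) ∎
  where
  open ≡-Reasoning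
  h = leading (suc y) λ′
  v = n ∸ suc h
  E = extremal n y (suc a) λ′
  rowWeight-replicate : ∀ m → rowWeight (replicate m (a , a)) ≡ m
  rowWeight-replicate zero    = refl
  rowWeight-replicate (suc m) = cong₂ _+_ (m+n∸n≡m 1 a) (rowWeight-replicate m)

ProperFrom : ℕ → ℕ → Interval → Set
ProperFrom n a b = Proper n b × a ≤ lo b

stack-properFrom : ∀ {n a} c v rows → suc v + c ≤ n → a ≤ v → All (All (ProperFrom n a)) rows →
                   All (All (ProperFrom n a)) (stack c v rows)
stack-properFrom zero    v rows       _      _   p        = p
stack-properFrom (suc c) v []         _      _   []       = []
stack-properFrom {n} (suc c) v (r ∷ rows) v+c<n a≤v (p ∷ ps) =
  All.++⁺ p (((≤-refl , ≤-trans (s≤s (m≤m+n (suc v) c)) v+c<n′) , m≤n⇒m≤1+n a≤v) ∷ [])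
  ∷ stack-properFrom c (suc v) rows v+c<n′ (m≤n⇒m≤1+n a≤v) ps
  where
  v+c<n′ : suc (suc v) + c ≤ n
  v+c<n′ = subst (_≤ n) (+-suc (suc v) c) v+c<n

extremal-properFrom : ∀ n cap a λ′ → a + length λ′ ≤ n → All (All (ProperFrom n a)) (extremal n cap a λ′)
extremal-properFrom n cap a []       _ = []
extremal-properFrom n cap a (x ∷ λ′) a+ℓ≤n with x ⊓ cap
... | zero  = [] ∷ All.map⁺ (All.universal (λ _ → []) λ′)
... | suc y = All.++⁺ (All.replicate⁺ y ((≤-refl , a<n) , ≤-refl)) (((a≤v , v<n) , ≤-refl) ∷ [])
            ∷ stack-properFrom h v E (≤-reflexive 1+v+h≡n) a≤v
                (All.map (All.map (λ (p , 1+a≤b) → p , ≤-trans (n≤1+n a) 1+a≤b))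
                         (extremal-properFrom n y (suc a) λ′ (subst (_≤ n) (+-suc a (length λ′)) a+ℓ≤n)))
  where
  h = leading (suc y) λ′
  v = n ∸ suc h
  E = extremal n y (suc a) λ′
  a≤v = proj₁ (stack-base a h n (leading-fits a (suc y) x λ′ a+ℓ≤n))
  v<n = proj₁ (proj₂ (stack-base a h n (leading-fits a (suc y) x λ′ a+ℓ≤n)))
  1+v+h≡n = proj₂ (proj₂ (stack-base a h n (leading-fits a (suc y) x λ′ a+ℓ≤n)))
  a<n = ≤-<-trans a≤v v<n

lengths-bounded : ∀ y (rows : List (List Interval)) λ′ → map length rows ≡ map (_⊓ y) λ′ → All (λ q → length q ≤ y) rows
lengths-bounded y []         []       _       = []
lengths-bounded y (r ∷ rows) (t ∷ λ′) lengths =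
  subst (_≤ y) (sym (List.∷-injectiveˡ lengths)) (m⊓n≤n t y) ∷ lengths-bounded y rows λ′ (List.∷-injectiveʳ lengths)

lengths-leading : ∀ y c (rows : List (List Interval)) λ′ → map length rows ≡ map (_⊓ y) λ′ →
                  All (suc y ≤_) (take c λ′) → All (λ q → length q ≡ y) (take c rows)
lengths-leading y zero    rows       λ′       _       _            = []
lengths-leading y (suc c) []         λ′       _       _            = []
lengths-leading y (suc c) (r ∷ rows) (t ∷ λ′) lengths (y<t ∷ long) =
  trans (List.∷-injectiveˡ lengths) (m≥n⇒m⊓n≡n (≤-pred (m≤n⇒m≤1+n y<t)))
  ∷ lengths-leading y c rows λ′ (List.∷-injectiveʳ lengths) long

linked-snoc : ∀ {A : Set} {R : A → A → Set} b r x → Linked R (b ∷ r) → R (last-of b r) x → Linked R (b ∷ r ++ [ x ])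
linked-snoc b []      x [-]         Rbx = Rbx ∷ [-]
linked-snoc b (c ∷ r) x (Rbc ∷ row) Rzx = Rbc ∷ linked-snoc c r x row Rzx

stack-rows : ∀ {n} y c v rows → suc v + c ≡ n → c ≤ length rows → All (λ q → length q ≡ y) (take c rows) →
             All (All (Proper n)) rows → Linked ColumnStrict rows → All (Linked _≤ᴵ_) rows → All (Linked _≤ᴵ_) (stack c v rows)
stack-rows y zero    v rows       _      _         _              _ _  rs         = rs
stack-rows y (suc c) v []         _      _         _              _ _  _          = []
stack-rows {n} y (suc c) v (r ∷ rows) v+c≡n (s≤s c≤) (r≡y ∷ rows≡y) ps cs (row ∷ rs) =
  extend r r≡y row ps cs ∷ stack-rows y c (suc v) rows (trans (sym (+-suc (suc v) c)) v+c≡n) c≤ rows≡y (All.tail ps) (Linked.tail cs) rs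
  where
  extend : ∀ r → length r ≡ y → Linked _≤ᴵ_ r → All (All (Proper n)) (r ∷ rows) → Linked ColumnStrict (r ∷ rows) →
           Linked _≤ᴵ_ (r ++ [ suc v , suc v ])
  extend []       _   _   _  _  = [-]
  extend (b ∷ r′) r≡y row ps cs = linked-snoc b r′ _ row (+-cancelʳ-≤ c _ _ (≤-pred (begin
    suc (hi (last-of b r′) + c) ≤⟨ column-top (length r′) (last-of b r′) [] (b ∷ r′) rows c ps cs (drop-last-of b r′) c≤
                                     (All.map (λ q≡y → ≤-reflexive (trans r≡y (sym q≡y))) rows≡y) ⟩
    n                          ≡⟨ v+c≡n ⟨
    suc v + suc c              ≡⟨ +-suc (suc v) c ⟩
    suc (suc v + c)            ∎)))
    where open ≤-Reasoning

columnStrict-snoc : ∀ l u x x′ → ColumnStrict l u → length l ≡ length u → x <ᴵ x′ → ColumnStrict (l ++ [ x ]) (u ++ [ x′ ])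
columnStrict-snoc []      []      x x′ _       _ x<x′ = x<x′ , tt
columnStrict-snoc (b ∷ l) (c ∷ u) x x′ (b<c , s) l≡u x<x′ = b<c , columnStrict-snoc l u x x′ s (suc-injective l≡u) x<x′

columnStrict-snocˡ : ∀ l u x → ColumnStrict l u → length u ≤ length l → ColumnStrict (l ++ [ x ]) u
columnStrict-snocˡ l       []      x _         _         = columnStrict-[]ʳ (l ++ [ x ])
columnStrict-snocˡ (b ∷ l) (c ∷ u) x (b<c , s) (s≤s u≤l) = b<c , columnStrict-snocˡ l u x s u≤l

columnStrict-replicate : ∀ m a u → All (λ b → suc a ≤ lo b) u → ColumnStrict (replicate m (a , a)) u
columnStrict-replicate zero    a u       _          = tt
columnStrict-replicate (suc m) a []      _          = tt
columnStrict-replicate (suc m) a (c ∷ u) (a<c ∷ as) = a<c , columnStrict-replicate m a u as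

stack-columns : ∀ y c v rows → All (λ q → length q ≡ y) (take c rows) → All (λ q → length q ≤ y) rows →
                Linked ColumnStrict rows → Linked ColumnStrict (stack c v rows)
stack-columns y zero          v rows           _                _           cs        = cs
stack-columns y (suc c)       v []             _                _           _         = []
stack-columns y (suc zero)    v (r ∷ [])       _                _           _         = [-]
stack-columns y (suc (suc c)) v (r ∷ [])       _                _           _         = [-]
stack-columns y (suc zero)    v (r ∷ q ∷ rows) (r≡y ∷ _)        (_ ∷ q≤y ∷ _) (r<q ∷ cs) =
  columnStrict-snocˡ r q _ r<q (subst (length q ≤_) (sym r≡y) q≤y) ∷ cs
stack-columns y (suc (suc c)) v (r ∷ q ∷ rows) (r≡y ∷ q≡y ∷ ls) (_ ∷ bounded) (r<q ∷ cs) =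
  columnStrict-snoc r q _ _ r<q (trans r≡y (sym q≡y)) ≤-refl ∷ stack-columns y (suc c) (suc v) (q ∷ rows) (q≡y ∷ ls) bounded cs

hook-columns : ∀ y a v c rows → All (λ q → length q ≡ y) (take c rows) → All (λ q → length q ≤ y) rows →
               AtLeast (suc a) rows → Linked ColumnStrict (stack c v rows) → Linked ColumnStrict (hookRow y a v ∷ stack c v rows)
hook-columns y a v zero    []       _         _         _        _  = [-]
hook-columns y a v (suc c) []       _         _         _        _  = [-]
hook-columns y a v zero    (r ∷ rows) _       (r≤y ∷ _) (a<r ∷ _) cs =
  columnStrict-snocˡ (replicate y (a , a)) r _ (columnStrict-replicate y a r a<r)
                     (subst (length r ≤_) (sym (List.length-replicate y)) r≤y) ∷ cs
hook-columns y a v (suc c) (r ∷ rows) (r≡y ∷ _) _       (a<r ∷ _) cs =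
  columnStrict-snoc (replicate y (a , a)) r _ _ (columnStrict-replicate y a r a<r)
                    (trans (List.length-replicate y) (sym r≡y)) ≤-refl ∷ cs

hookRow-ordered : ∀ y a v → Linked _≤ᴵ_ (hookRow y a v)
hookRow-ordered zero          a v = [-]
hookRow-ordered (suc zero)    a v = ≤-refl ∷ [-]
hookRow-ordered (suc (suc y)) a v = ≤-refl ∷ hookRow-ordered (suc y) a v

empty-rows-columns : ∀ (λ′ : List ℕ) → Linked ColumnStrict ([] ∷ map (λ _ → []) λ′)
empty-rows-columns []       = [-]
empty-rows-columns (_ ∷ λ′) = tt ∷ empty-rows-columns λ′

extremal-columns : ∀ n cap a λ′ → a + length λ′ ≤ n → Linked _≥_ λ′ → Linked ColumnStrict (extremal n cap a λ′)
extremal-columns n cap a []       _     _ = []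
extremal-columns n cap a (x ∷ λ′) a+ℓ≤n d with x ⊓ cap
... | zero  = empty-rows-columns λ′
... | suc y = hook-columns y a v h E (lengths-leading y h E λ′ shape (leading-≥ (suc y) λ′)) (lengths-bounded y E λ′ shape)
                (All.map (All.map proj₂) (extremal-properFrom n y (suc a) λ′ a+ℓ≤n′))
                (stack-columns y h v E (lengths-leading y h E λ′ shape (leading-≥ (suc y) λ′)) (lengths-bounded y E λ′ shape)
                               (extremal-columns n y (suc a) λ′ a+ℓ≤n′ (Linked.tail d)))
  where
  h = leading (suc y) λ′
  v = n ∸ suc h
  E = extremal n y (suc a) λ′
  a+ℓ≤n′ = subst (_≤ n) (+-suc a (length λ′)) a+ℓ≤n
  shape = extremal-shape n y (suc a) λ′ (Linked.tail d)

extremal-rows : ∀ n cap a λ′ → a + length λ′ ≤ n → Linked _≥_ λ′ → All (Linked _≤ᴵ_) (extremal n cap a λ′)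
extremal-rows n cap a []       _     _ = []
extremal-rows n cap a (x ∷ λ′) a+ℓ≤n d with x ⊓ cap
... | zero  = [] ∷ All.map⁺ (All.universal (λ _ → []) λ′)
... | suc y = hookRow-ordered y a v
            ∷ stack-rows y h v E 1+v+h≡n (subst (h ≤_) (sym (extremal-length n y (suc a) λ′)) (leading≤length (suc y) λ′))
                (lengths-leading y h E λ′ (extremal-shape n y (suc a) λ′ (Linked.tail d)) (leading-≥ (suc y) λ′))
                (All.map (All.map proj₁) (extremal-properFrom n y (suc a) λ′ a+ℓ≤n′))
                (extremal-columns n y (suc a) λ′ a+ℓ≤n′ (Linked.tail d))
                (extremal-rows n y (suc a) λ′ a+ℓ≤n′ (Linked.tail d))
  where
  h = leading (suc y) λ′
  v = n ∸ suc h
  E = extremal n y (suc a) λ′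
  a+ℓ≤n′ = subst (_≤ n) (+-suc a (length λ′)) a+ℓ≤n
  1+v+h≡n = proj₂ (proj₂ (stack-base a h n (leading-fits a (suc y) x λ′ a+ℓ≤n)))

extremal-tableau : ∀ n cap a λ′ → a + length λ′ ≤ n → Linked _≥_ λ′ → IntervalTableau n (extremal n cap a λ′)
extremal-tableau n cap a λ′ a+ℓ≤n d = record
  { proper     = All.map (All.map proj₁) (extremal-properFrom n cap a λ′ a+ℓ≤n)
  ; rows       = extremal-rows n cap a λ′ a+ℓ≤n d
  ; columns    = extremal-columns n cap a λ′ a+ℓ≤n d
  ; decreasing = subst (Linked _≥_) (sym (extremal-shape n cap a λ′ d))
                       (Linked.map⁺ (Linked.map (⊓-monoˡ-≤ cap) d))
  }

-- From set-valued tableaux to interval tableaux and back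

∧-intro : ∀ {x y} → T x → T y → T (x ∧ y)
∧-intro p q = Equivalence.from T-∧ (p , q)

∧-elim : ∀ x {y} → T (x ∧ y) → T x × T y
∧-elim _ = Equivalence.to T-∧

rowOK⇒nonempty : (r : List (Subset n)) → T (rowOKᵇ r) → All (T ∘ nonemptyᵇ) r
rowOK⇒nonempty []           _ = []
rowOK⇒nonempty (S ∷ [])     p = p ∷ []
rowOK⇒nonempty (S ∷ S′ ∷ r) p = proj₁ (∧-elim (nonemptyᵇ S) p) ∷ rowOK⇒nonempty (S′ ∷ r) (proj₂ (∧-elim (maxLeMinᵇ S S′) (proj₂ (∧-elim (nonemptyᵇ S) p))))

valid⇒rowOK : (T′ : Filling n) → T (validᵇ T′) → All (T ∘ rowOKᵇ) T′
valid⇒rowOK []           _ = []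
valid⇒rowOK (r ∷ [])     p = p ∷ []
valid⇒rowOK (r ∷ r′ ∷ T′) p = proj₁ (∧-elim (rowOKᵇ r) p) ∷ valid⇒rowOK (r′ ∷ T′) (proj₂ (∧-elim (colOKᵇ r r′) (proj₂ (∧-elim (rowOKᵇ r) p))))

valid⇒colOK : (T′ : Filling n) → T (validᵇ T′) → Linked (λ r r′ → T (colOKᵇ r r′)) T′
valid⇒colOK []            _ = []
valid⇒colOK (r ∷ [])      _ = [-]
valid⇒colOK (r ∷ r′ ∷ T′) p = let _ , q = ∧-elim (rowOKᵇ r) p ; c , v = ∧-elim (colOKᵇ r r′) q in c ∷ valid⇒colOK (r′ ∷ T′) v

valid⁺ : (T′ : Filling n) → All (T ∘ rowOKᵇ) T′ → Linked (λ r r′ → T (colOKᵇ r r′)) T′ → T (validᵇ T′)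
valid⁺ []            _             _         = tt
valid⁺ (r ∷ [])      (p ∷ _)       _         = p
valid⁺ (r ∷ r′ ∷ T′) (p ∷ ps)      (c ∷ cs)  = ∧-intro p (∧-intro c (valid⁺ (r′ ∷ T′) ps cs))

hull : Subset n → Interval
hull S = least S , greatest S

hull-proper : (S : Subset n) → T (nonemptyᵇ S) → Proper n (hull S)
hull-proper {n} S ne with nonempty⁻ S ne
... | i , i∈S = ≤-trans (least≤ S i i∈S) (≤greatest S i i∈S)
              , (let j , _ , j≡g = greatest-∈ S i i∈S in subst (_< n) j≡g (toℕ<n j))

hull-≤ : (S S′ : Subset n) → T (nonemptyᵇ S) → T (nonemptyᵇ S′) → T (maxLeMinᵇ S S′) → hull S ≤ᴵ hull S′
hull-≤ S S′ ne ne′ p = ≤ᵇ⇒≤ _ _ (extremes-related _≤ᵇ_ S S′ ne ne′ p)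

hull-< : (S S′ : Subset n) → T (nonemptyᵇ S) → T (nonemptyᵇ S′) → T (maxLtMinᵇ S S′) → hull S <ᴵ hull S′
hull-< S S′ ne ne′ p = <ᵇ⇒< _ _ (extremes-related _<ᵇ_ S S′ ne ne′ p)

hulls : Filling n → List (List Interval)
hulls = map (map hull)

hulls-row : (r : List (Subset n)) → T (rowOKᵇ r) → Linked _≤ᴵ_ (map hull r)
hulls-row []           _ = []
hulls-row (S ∷ [])     _ = [-]
hulls-row (S ∷ S′ ∷ r) p =
  let ne , q = ∧-elim (nonemptyᵇ S) p ; S≤S′ , ok = ∧-elim (maxLeMinᵇ S S′) q
  in hull-≤ S S′ ne (All.head (rowOK⇒nonempty (S′ ∷ r) ok)) S≤S′ ∷ hulls-row (S′ ∷ r) ok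

hulls-columns : (l u : List (Subset n)) → All (T ∘ nonemptyᵇ) l → All (T ∘ nonemptyᵇ) u → T (colOKᵇ l u) →
                ColumnStrict (map hull l) (map hull u)
hulls-columns []      u        _          _          _ = tt
hulls-columns (S ∷ l) []       _          _          _ = tt
hulls-columns (S ∷ l) (S′ ∷ u) (ne ∷ nes) (ne′ ∷ nes′) p =
  let S<S′ , ok = ∧-elim (maxLtMinᵇ S S′) p in hull-< S S′ ne ne′ S<S′ , hulls-columns l u nes nes′ ok

length-hulls : ∀ {n} (T′ : Filling n) → map length (hulls T′) ≡ map length T′
length-hulls T′ = trans (sym (List.map-∘ T′)) (List.map-cong (List.length-map hull) T′)

hulls-tableau : (T′ : Filling n) → T (validᵇ T′) → Linked _≥_ (map length T′) → IntervalTableau n (hulls T′)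
hulls-tableau T′ valid lengths = record
  { proper     = All.map⁺ (All.map (λ {r} ok → All.map⁺ (All.map (λ {S} → hull-proper S) (rowOK⇒nonempty r ok))) rowsOK)
  ; rows       = All.map⁺ (All.map (λ {r} → hulls-row r) rowsOK)
  ; columns    = strict T′ rowsOK (valid⇒colOK T′ valid)
  ; decreasing = subst (Linked _≥_) (sym (length-hulls T′)) lengths
  }
  where
  rowsOK = valid⇒rowOK T′ valid
  strict : (T′ : Filling n) → All (T ∘ rowOKᵇ) T′ → Linked (λ r r′ → T (colOKᵇ r r′)) T′ → Linked ColumnStrict (hulls T′)
  strict []            _                _        = []
  strict (r ∷ [])      _                _        = [-]
  strict (r ∷ r′ ∷ T′) (ok ∷ ok′ ∷ oks) (c ∷ cs) =
    hulls-columns r r′ (rowOK⇒nonempty r ok) (rowOK⇒nonempty r′ ok′) c ∷ strict (r′ ∷ T′) (ok′ ∷ oks) cs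

⟦_⟧ : Interval → Subset n
⟦ b ⟧ = segment (lo b) (width b)

∈⟦⟧⁻ : ∀ b (i : Fin n) → i ∈ˢ ⟦ b ⟧ → lo b ≤ toℕ i × toℕ i ≤ hi b
∈⟦⟧⁻ b i i∈b with ∈-segment⁻ (lo b) (width b) i i∈b | lo b ≤? suc (hi b)
... | lo≤i , i<end | yes lo≤1+hi = lo≤i , ≤-pred (subst (toℕ i <_) (m+[n∸m]≡n lo≤1+hi) i<end)
... | lo≤i , i<end | no  lo≰1+hi = ⊥-elim (<⇒≱ (subst (toℕ i <_) (trans (cong (lo b +_) (m≤n⇒m∸n≡0 (<⇒≤ (≰⇒> lo≰1+hi)))) (+-identityʳ (lo b))) i<end) lo≤i)

⟦⟧-nonempty : ∀ b → Proper n b → T (nonemptyᵇ {n} ⟦ b ⟧)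
⟦⟧-nonempty {n} b (lo≤hi , hi<n) = nonempty⁺ (⟦_⟧ {n} b) (fromℕ< (≤-<-trans lo≤hi hi<n))
  (∈-segment⁺ {n} (lo b) (width b) _ (≤-reflexive (sym (toℕ-fromℕ< _)))
    (subst (_< lo b + width b) (sym (toℕ-fromℕ< _)) (subst (lo b <_) (sym (m+[n∸m]≡n (m≤n⇒m≤1+n lo≤hi))) (s≤s lo≤hi))))

⟦⟧-≤ : ∀ b c → b ≤ᴵ c → T (maxLeMinᵇ {n} ⟦ b ⟧ ⟦ c ⟧)
⟦⟧-≤ {n} b c b≤c = pairwise⁺ _≤ᵇ_ (⟦_⟧ {n} b) ⟦ c ⟧ λ i j i∈b j∈c →
  ≤⇒≤ᵇ (≤-trans (proj₂ (∈⟦⟧⁻ b i i∈b)) (≤-trans b≤c (proj₁ (∈⟦⟧⁻ c j j∈c))))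

⟦⟧-< : ∀ b c → b <ᴵ c → T (maxLtMinᵇ {n} ⟦ b ⟧ ⟦ c ⟧)
⟦⟧-< {n} b c b<c = pairwise⁺ _<ᵇ_ (⟦_⟧ {n} b) ⟦ c ⟧ λ i j i∈b j∈c →
  <⇒<ᵇ (≤-<-trans (proj₂ (∈⟦⟧⁻ b i i∈b)) (<-≤-trans b<c (proj₁ (∈⟦⟧⁻ c j j∈c))))

card-⟦⟧ : ∀ b → Proper n b → card {n} ⟦ b ⟧ ≡ width b
card-⟦⟧ {n} b (lo≤hi , hi<n) = card-segment {n} (lo b) (width b) (subst (_≤ n) (sym (m+[n∸m]≡n (m≤n⇒m≤1+n lo≤hi))) hi<n)

realise : List (List Interval) → Filling n
realise = map (map ⟦_⟧)

realise-row : ∀ r → All (Proper n) r → Linked _≤ᴵ_ r → T (rowOKᵇ (map (⟦_⟧ {n}) r))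
realise-row []           _            _           = tt
realise-row (b ∷ [])     (p ∷ _)      _           = ⟦⟧-nonempty b p
realise-row {n} (b ∷ c ∷ r)  (p ∷ ps)     (b≤c ∷ row) = ∧-intro (⟦⟧-nonempty b p) (∧-intro (⟦⟧-≤ {n} b c b≤c) (realise-row (c ∷ r) ps row))

realise-columns : ∀ l u → ColumnStrict l u → T (colOKᵇ (map (⟦_⟧ {n}) l) (map ⟦_⟧ u))
realise-columns []      u       _         = tt
realise-columns (b ∷ l) []      _         = tt
realise-columns {n} (b ∷ l) (c ∷ u) (b<c , s) = ∧-intro (⟦⟧-< {n} b c b<c) (realise-columns l u s)

realise-valid : ∀ P → IntervalTableau n P → T (validᵇ (realise {n} P))
realise-valid P t = valid⁺ (realise P)
  (All.map⁺ (All.zipWith (λ (p , row) → realise-row _ p row) (proper t , rows t)))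
  (Linked.map⁺ (Linked.map (λ {l} {u} → realise-columns l u) (columns t)))

vsum-tabulate-+ : ∀ {n} (f g : Fin n → ℕ) → vsum (tabulate (λ i → f i + g i)) ≡ vsum (tabulate f) + vsum (tabulate g)
vsum-tabulate-+ {zero}  f g = refl
vsum-tabulate-+ {suc n} f g = trans (cong (f _ + g _ +_) (vsum-tabulate-+ (f ∘ fsuc) (g ∘ fsuc)))
                                    (+-interchange (f _) (g _) (vsum (tabulate (f ∘ fsuc))) (vsum (tabulate (g ∘ fsuc))))

vsum-tabulate-0 : ∀ n → vsum (tabulate {n = n} (λ _ → 0)) ≡ 0
vsum-tabulate-0 zero    = refl
vsum-tabulate-0 (suc n) = vsum-tabulate-0 n

card≡vsum : (S : Subset n) → card S ≡ vsum (tabulate (λ i → if lookup S i then 1 else 0))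
card≡vsum Vec.[]          = refl
card≡vsum (true Vec.∷ S)  = cong suc (card≡vsum S)
card≡vsum (false Vec.∷ S) = card≡vsum S

d≡sum-card : (T′ : Filling n) → d T′ ≡ sum (map card (concat T′))
d≡sum-card {n} T′ = go (concat T′)
  where
  go : (Ss : List (Subset n)) → vsum (tabulate (λ i → sum (map (λ S → if lookup S i then 1 else 0) Ss))) ≡ sum (map card Ss)
  go []       = vsum-tabulate-0 n
  go (S ∷ Ss) = trans (vsum-tabulate-+ (λ i → if lookup S i then 1 else 0) (λ i → sum (map (λ S → if lookup S i then 1 else 0) Ss))) (cong₂ _+_ (sym (card≡vsum S)) (go Ss))

weight≡sum-width : ∀ P → weight P ≡ sum (map width (concat P))
weight≡sum-width []      = refl
weight≡sum-width (r ∷ P) = trans (cong (rowWeight r +_) (weight≡sum-width P))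
                                 (sym (trans (cong sum (List.map-++ width r (concat P))) (sum-++ (map width r) _)))

sum-map-mono : ∀ {A : Set} {f g : A → ℕ} {xs} → All (λ x → f x ≤ g x) xs → sum (map f xs) ≤ sum (map g xs)
sum-map-mono []         = z≤n
sum-map-mono (fx≤ ∷ le) = +-mono-≤ fx≤ (sum-map-mono le)

d≤weight-hulls : (T′ : Filling n) → T (validᵇ T′) → d T′ ≤ weight (hulls T′)
d≤weight-hulls T′ valid = begin
  d T′                                     ≡⟨ d≡sum-card T′ ⟩
  sum (map card (concat T′))               ≤⟨ sum-map-mono (All.map (λ {S} → card≤extent S) nonempty) ⟩
  sum (map (width ∘ hull) (concat T′))     ≡⟨ cong sum (List.map-∘ (concat T′)) ⟩
  sum (map width (map hull (concat T′)))   ≡⟨ cong (sum ∘ map width) (List.concat-map T′) ⟨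
  sum (map width (concat (hulls T′)))      ≡⟨ weight≡sum-width (hulls T′) ⟨
  weight (hulls T′)                        ∎
  where
  open ≤-Reasoning
  nonempty = All.concat⁺ (All.map (λ {r} → rowOK⇒nonempty r) (valid⇒rowOK T′ valid))

d-realise : ∀ P → All (All (Proper n)) P → d (realise {n} P) ≡ weight P
d-realise {n} P proper = begin
  d (realise {n} P)                          ≡⟨ d≡sum-card (realise P) ⟩
  sum (map card (concat (realise {n} P)))    ≡⟨ cong (sum ∘ map card) (List.concat-map P) ⟩
  sum (map card (map (⟦_⟧ {n}) (concat P)))  ≡⟨ cong sum (List.map-∘ (concat P)) ⟨
  sum (map (card ∘ ⟦_⟧ {n}) (concat P))      ≡⟨ cong sum (List.map-cong-local (All.map (λ {b} → card-⟦⟧ b) (All.concat⁺ proper))) ⟩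
  sum (map width (concat P))                 ≡⟨ weight≡sum-width P ⟨
  weight P                                   ∎
  where open ≡-Reasoning

-- Enumeration of SVT(λ, n) and the coefficients of G

module _ {A : Set} where

  ∈-conses⁺ : ∀ {x : A} {y : List A} {xs : List A} {ys : List (List A)} → x ∈ xs → y ∈ ys → x ∷ y ∈ concatMap (λ x → map (x ∷_) ys) xs
  ∈-conses⁺ {y = y} x∈xs y∈ys = ∈-concatMap⁺ _ (Any.map (λ { refl → ∈-map⁺ _ y∈ys }) x∈xs)

  ∈-conses⁻ : ∀ {z : List A} {xs : List A} {ys : List (List A)} → z ∈ concatMap (λ x → map (x ∷_) ys) xs → ∃₂ λ x y → z ≡ x ∷ y × x ∈ xs × y ∈ ys
  ∈-conses⁻ {xs = xs} z∈ =
    let x , x∈xs , z∈map = find (∈-concatMap⁻ _ {xs = xs} z∈) ; y , y∈ys , z≡ = ∈-map⁻ _ z∈map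
    in x , y , z≡ , x∈xs , y∈ys

∈-allSubsets : ∀ {n} (S : Subset n) → S ∈ allSubsets n
∈-allSubsets Vec.[]          = here refl
∈-allSubsets (b Vec.∷ S) = ∈-concatMap⁺ _ (Any.map (λ { refl → both b }) (∈-allSubsets S))
  where
  both : ∀ b → (b Vec.∷ S) ∈ (false Vec.∷ S) ∷ (true Vec.∷ S) ∷ []
  both false = here refl
  both true  = there (here refl)

∈-allRows⁺ : ∀ n k (r : List (Subset n)) → length r ≡ k → r ∈ allRows n k
∈-allRows⁺ n zero    []      _     = here refl
∈-allRows⁺ n (suc k) (S ∷ r) 1+r≡k = ∈-conses⁺ (∈-allSubsets S) (∈-allRows⁺ n k r (suc-injective 1+r≡k))

∈-allRows⁻ : ∀ n k (r : List (Subset n)) → r ∈ allRows n k → length r ≡ k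
∈-allRows⁻ n zero    r (here refl) = refl
∈-allRows⁻ n (suc k) r r∈ with ∈-conses⁻ {xs = allSubsets n} r∈
... | S , r′ , refl , _ , r′∈ = cong suc (∈-allRows⁻ n k r′ r′∈)

∈-allFillings⁺ : ∀ n λ′ (T′ : Filling n) → map length T′ ≡ λ′ → T′ ∈ allFillings n λ′
∈-allFillings⁺ n []       []       _ = here refl
∈-allFillings⁺ n (k ∷ λ′) (r ∷ T′) e =
  ∈-conses⁺ (∈-allRows⁺ n k r (List.∷-injectiveˡ e)) (∈-allFillings⁺ n λ′ T′ (List.∷-injectiveʳ e))

∈-allFillings⁻ : ∀ n λ′ (T′ : Filling n) → T′ ∈ allFillings n λ′ → map length T′ ≡ λ′
∈-allFillings⁻ n []       T′ (here refl) = refl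
∈-allFillings⁻ n (k ∷ λ′) T′ T∈ with ∈-conses⁻ {xs = allRows n k} T∈
... | r , T″ , refl , r∈ , T″∈ = cong₂ _∷_ (∈-allRows⁻ n k r r∈) (∈-allFillings⁻ n λ′ T″ T″∈)

∈SVT⁺ : ∀ λ′ n (T′ : Filling n) → map length T′ ≡ λ′ → T (validᵇ T′) → T′ ∈ SVT λ′ n
∈SVT⁺ λ′ n T′ shape valid = ∈-filter⁺ (λ U → Dec.T? (validᵇ U)) (∈-allFillings⁺ n λ′ T′ shape) valid

∈SVT⁻ : ∀ λ′ n (T′ : Filling n) → T′ ∈ SVT λ′ n → map length T′ ≡ λ′ × T (validᵇ T′)
∈SVT⁻ λ′ n T′ T∈ = let T∈all , valid = ∈-filter⁻ (λ U → Dec.T? (validᵇ U)) {xs = allFillings n λ′} T∈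
                   in ∈-allFillings⁻ n λ′ T′ T∈all , valid

module Coefficient (λ′ : List ℕ) (n : ℕ) (c : Vec ℕ n) where

  open import Data.Integer using (ℤ; +_; -_)

  term : Filling n → ℤ
  term T′ = if ⌊ Vec.≡-dec _≟_ (content T′) c ⌋ then (- (+ 1)) ℤ.^ (d T′ ∸ size λ′) else + 0

  total : List (Filling n) → ℤ
  total L = foldr ℤ._+_ (+ 0) (map term L)

  total≢0⇒∃ : ∀ L → ¬ total L ≡ + 0 → ∃[ T′ ] T′ ∈ L × content T′ ≡ c
  total≢0⇒∃ []       total≢0 = ⊥-elim (total≢0 refl)
  total≢0⇒∃ (T′ ∷ L) total≢0 with Vec.≡-dec _≟_ (content T′) c
  ... | yes T≡c = T′ , here refl , T≡c
  ... | no  _   = let U , U∈L , U≡c = total≢0⇒∃ L (λ total≡0 → total≢0 (trans (ℤ.+-identityˡ _) total≡0))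
                  in U , there U∈L , U≡c

  -- Every tableau of content c has the same sign, so no cancellation can occur.
  sign : ℤ
  sign = (- (+ 1)) ℤ.^ (vsum c ∸ size λ′)

  total≡sign*count : ∀ L → ∃[ k ] total L ≡ sign ℤ.* + k × (∀ {T′} → T′ ∈ L → content T′ ≡ c → 1 ≤ k)
  total≡sign*count []       = 0 , sym (ℤ.*-zeroʳ sign) , λ ()
  total≡sign*count (T′ ∷ L) with total≡sign*count L | Vec.≡-dec _≟_ (content T′) c
  ... | k , total≡ , _ | yes T≡c =
    suc k , trans (cong₂ ℤ._+_ (cong (λ v → (- (+ 1)) ℤ.^ (vsum v ∸ size λ′)) T≡c) total≡)
                  (trans (cong (ℤ._+ sign ℤ.* + k) (sym (ℤ.*-identityʳ sign))) (sym (ℤ.*-distribˡ-+ sign (+ 1) (+ k))))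
          , λ _ _ → s≤s z≤n
  ... | k , total≡ , 1≤k | no T≢c =
    k , trans (ℤ.+-identityˡ _) total≡ , λ { (here refl) T≡c → ⊥-elim (T≢c T≡c) ; (there U∈L) → 1≤k U∈L }

  ∈⇒total≢0 : ∀ L {T′} → T′ ∈ L → content T′ ≡ c → ¬ total L ≡ + 0
  ∈⇒total≢0 L T∈L T≡c total≡0 with total≡sign*count L
  ... | k , total≡ , 1≤k with ℤ.i*j≡0⇒i≡0∨j≡0 sign (trans (sym total≡) total≡0)
  ...   | inj₁ sign≡0 with () ← ℤ.i^n≡0⇒i≡0 (- (+ 1)) (vsum c ∸ size λ′) sign≡0
  ...   | inj₂ k≡0 = <⇒≱ (1≤k T∈L T≡c) (≤-reflexive (ℤ.+-injective k≡0))

GCoeff-degree : ∀ λ′ n D → (∀ T′ → T′ ∈ SVT λ′ n → d T′ ≤ D) → (∃[ T′ ] T′ ∈ SVT λ′ n × d T′ ≡ D) →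
                HasDegree (GCoeff λ′ n) D
GCoeff-degree λ′ n D upper (T′ , T∈ , d≡D) =
  (content T′ , Coefficient.∈⇒total≢0 λ′ n (content T′) (SVT λ′ n) T∈ refl , d≡D) ,
  λ c c≢0 → let U , U∈ , U≡c = Coefficient.total≢0⇒∃ λ′ n c (SVT λ′ n) c≢0
            in subst (_≤ D) (cong vsum U≡c) (upper U U∈)

parts≤head : ∀ λ′ → Linked _≥_ λ′ → All (_≤ part λ′ 0) λ′
parts≤head []       _ = []
parts≤head (x ∷ λ′) d = Linked.Linked⇒All (λ y≤x z≤y → ≤-trans z≤y y≤x) ≤-refl d

d≤hookBound : ∀ λ′ n (T′ : Filling n) → Linked _≥_ λ′ → T′ ∈ SVT λ′ n → d T′ ≤ hookBound n 0 (greedy (part λ′ 0) λ′)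
d≤hookBound λ′ n T′ decreasing T∈ = begin
  d T′                                                    ≤⟨ d≤weight-hulls T′ valid ⟩
  weight (hulls T′)                                       ≡⟨ cong weight untruncated ⟨
  weight (map (take cap) (hulls T′))                      ≤⟨ weight-bound cap 0 (hulls T′) (hulls-tableau T′ valid lengths) lowest ⟩
  hookBound n 0 (greedy cap (map length (hulls T′)))      ≡⟨ cong (hookBound n 0 ∘ greedy cap) (trans (length-hulls T′) shape) ⟩
  hookBound n 0 (greedy cap λ′)                           ∎
  where
  open ≤-Reasoning
  cap = part λ′ 0
  shape = proj₁ (∈SVT⁻ λ′ n T′ T∈)
  valid = proj₂ (∈SVT⁻ λ′ n T′ T∈)
  lengths = subst (Linked _≥_) (sym shape) decreasing
  lowest = All.map⁺ (All.universal (λ r → All.universal (λ _ → z≤n) (map hull r)) T′)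
  untruncated : map (take cap) (hulls T′) ≡ hulls T′
  untruncated = trans (List.map-cong-local (All.map (λ {r} → List.take-all cap r)
                                             (All.map⁻ (subst (All (_≤ cap)) (sym (trans (length-hulls T′) shape)) (parts≤head λ′ decreasing)))))
                      (List.map-id (hulls T′))

extremal-∈SVT : ∀ λ′ n → Linked _≥_ λ′ → length λ′ ≤ n →
                ∃[ T′ ] T′ ∈ SVT λ′ n × d T′ ≡ hookBound n 0 (greedy (part λ′ 0) λ′)
extremal-∈SVT λ′ n decreasing ℓ≤n =
  realise P , ∈SVT⁺ λ′ n (realise P) shape (realise-valid P tableau) ,
  trans (d-realise P (proper tableau)) (extremal-weight n cap 0 λ′ ℓ≤n)
  where
  cap = part λ′ 0
  P = extremal n cap 0 λ′
  tableau = extremal-tableau n cap 0 λ′ ℓ≤n decreasing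
  shape : map length (realise {n} P) ≡ λ′
  shape = begin
    map length (realise P)     ≡⟨ List.map-∘ P ⟨
    map (length ∘ map ⟦_⟧) P   ≡⟨ List.map-cong (List.length-map ⟦_⟧) P ⟩
    map length P               ≡⟨ extremal-shape n cap 0 λ′ decreasing ⟩
    map (_⊓ cap) λ′            ≡⟨ List.map-cong-local (All.map m≤n⇒m⊓n≡m (parts≤head λ′ decreasing)) ⟩
    map (λ x → x) λ′           ≡⟨ List.map-id λ′ ⟩
    λ′                         ∎
    where open ≡-Reasoning

theorem5p5 : (λ' : List ℕ) → IsPartition λ' → (n : ℕ) → 1 ≤ n → length λ' ≤ n →
    (μ : List ℕ) → IsLargestStrictIn μ λ' →
    HasDegree (GCoeff λ' n) (size μ + length μ * n ∸ (length μ * suc (length μ)) / 2)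
theorem5p5 λ′ (_ , decreasing) n _ ℓ≤n μ largest =
  subst (HasDegree (GCoeff λ′ n)) bound≡formula
    (GCoeff-degree λ′ n bound (λ T′ → d≤hookBound λ′ n T′ decreasing) (extremal-∈SVT λ′ n decreasing ℓ≤n))
  where
  bound = hookBound n 0 (greedy (part λ′ 0) λ′)
  bound≡formula : bound ≡ size μ + length μ * n ∸ length μ * suc (length μ) / 2
  bound≡formula rewrite largest≡greedy λ′ μ largest =
    hookBound≡formula n (greedy (part λ′ 0) λ′) (≤-trans (length-greedy≤ (part λ′ 0) λ′) ℓ≤n)
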